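{- Let $P$ be any integral polytope in $\mathbb{R}^n$ and $\pi:\mathbb{R}^n\to\mathbb{R}^m$ any integral linear map. If $\pi(P)$ is integrally indecomposable and each vertex of $\pi(P)$ has only one preimage in $P$, then $P$ is integrally indecomposable.
   Context: An integral polytope is a convex polytope whose vertices have integer coordinates. An integral polytope is integrally decomposable if it is the Minkowski sum $A+B=\{a+b:a\in A,b\in B\}$ of two integral polytopes $A,B$ each with more than one point, and integrally indecomposable otherwise. A linear map $\pi:\mathbb{R}^n\to\mathbb{R}^m$ is integral if it maps integral points (points of $\mathbb{Z}^n$) to integral points (points of $\mathbb{Z}^m$).
   Formalization: Stated over the rationals: the polytopes, their Minkowski summands, vertices and preimages are sets of points of ℚ^n and ℚ^m rather than of $\mathbb{R}^n$ and $\mathbb{R}^m$. -}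

module Defs where

open import Data.Nat using (ℕ; zero; suc)
open import Data.Fin using (Fin; zero; suc)
open import Data.Integer using (ℤ)
open import Data.Rational using (ℚ; _/_; 0ℚ; 1ℚ; _+_; _*_; _-_; _≤_; _<_)
open import Data.Product using (Σ; ∃; _×_; _,_)
open import Relation.Binary.PropositionalEquality using (_≡_)
open import Relation.Nullary using (¬_)
open import Function.Bundles using (_⇔_)

-- Points of ℚⁿ (integral polytopes are rational, so their geometry is
-- faithfully captured by their rational points).
Point : ℕ → Set
Point n = Fin n → ℚ

ZPoint : ℕ → Set
ZPoint n = Fin n → ℤ

embed : ∀ {n} → ZPoint n → Point n
embed z i = z i / 1

Σᶠ : ∀ {k} → (Fin k → ℚ) → ℚ
Σᶠ {zero}  f = 0ℚ
Σᶠ {suc k} f = f zero + Σᶠ (λ i → f (suc i))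

-- Pointwise equality of points (avoids function extensionality issues).
_≈_ : ∀ {n} → Point n → Point n → Set
x ≈ y = ∀ i → x i ≡ y i

infix 4 _≈_
infixl 6 _⊕_
infixl 7 _·_

_⊕_ : ∀ {n} → Point n → Point n → Point n
(x ⊕ y) i = x i + y i

_·_ : ∀ {n} → ℚ → Point n → Point n
(t · x) i = t * x i

PSet : ℕ → Set₁
PSet n = Point n → Set

conv : ∀ {n k} → (Fin k → Point n) → PSet n
conv {n} {k} p x =
  Σ (Fin k → ℚ) λ w →
    (∀ j → 0ℚ ≤ w j) × (Σᶠ w ≡ 1ℚ) × (∀ i → x i ≡ Σᶠ (λ j → w j * p j i))

IsIntegralPolytope : ∀ {n} → PSet n → Set
IsIntegralPolytope {n} S =
  Σ ℕ λ k → Σ (Fin (suc k) → ZPoint n) λ g →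
    ∀ x → S x ⇔ conv (λ j → embed (g j)) x

_≐_ : ∀ {n} → PSet n → PSet n → Set
S ≐ T = ∀ x → S x ⇔ T x

_⊞_ : ∀ {n} → PSet n → PSet n → PSet n
(A ⊞ B) x = Σ _ λ a → Σ _ λ b → A a × B b × (x ≈ a ⊕ b)

MoreThanOnePoint : ∀ {n} → PSet n → Set
MoreThanOnePoint A = Σ _ λ a → Σ _ λ a' → A a × A a' × ¬ (a ≈ a')

IntegrallyDecomposable : ∀ {n} → PSet n → Set₁
IntegrallyDecomposable {n} P =
  Σ (PSet n) λ A → Σ (PSet n) λ B →
    IsIntegralPolytope A × IsIntegralPolytope B ×
    MoreThanOnePoint A × MoreThanOnePoint B × (P ≐ (A ⊞ B))

IntegrallyIndecomposable : ∀ {n} → PSet n → Set₁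
IntegrallyIndecomposable P = ¬ IntegrallyDecomposable P

IsVertex : ∀ {n} → PSet n → Point n → Set
IsVertex S v =
  S v × (∀ x y t → S x → S y → 0ℚ < t → t < 1ℚ →
           v ≈ (t · x) ⊕ ((1ℚ - t) · y) → x ≈ v × y ≈ v)

-- Integral linear maps ℝⁿ → ℝᵐ are exactly those given by integer m×n
-- matrices; we apply them to rational points.
IntMatrix : ℕ → ℕ → Set
IntMatrix m n = Fin m → Fin n → ℤ

apply : ∀ {m n} → IntMatrix m n → Point n → Point m
apply M x i = Σᶠ (λ j → (M i j / 1) * x j)

image : ∀ {m n} → IntMatrix m n → PSet n → PSet m
image M P y = Σ _ λ x → P x × (apply M x ≈ y)

-- If P = A + B then π(P) = π(A) + π(B), and π(A), π(B) are integral polytopes, so by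
-- indecomposability of π(P) one of them, say π(A), is a single point.  Pick a vertex v of
-- π(P) (the lexicographic maximum of the images of the generators) and a preimage a + b ∈ P
-- of it.  Every a′ + b with a′ ∈ A then also lies in P over v, so uniqueness of the
-- preimage of v forces A to be a single point.

module Submission where

open import Defs
open import Algebra.Bundles using (CommutativeRing)
import Algebra.Properties.Group as GroupProperties
import Algebra.Properties.Monoid.Sum as MonoidSum
import Algebra.Properties.Semiring.Sum as SemiringSum
open import Data.Empty using (⊥-elim)
open import Data.Fin using (Fin; zero; suc)
open import Data.Fin.Properties using (all?; ¬∀⟶∃¬)
open import Data.Integer as ℤ using (ℤ)
import Data.Integer.Properties as ℤ
open import Data.Nat using (ℕ; zero; suc)
open import Data.Product using (∃; _×_; _,_; proj₁; proj₂)
open import Data.Rational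
  using (ℚ; 0ℚ; 1ℚ; _+_; _*_; _-_; -_; _≤_; _<_; _/_; positive; nonNegative)
open import Data.Rational.Literals using (fromℤ)
import Data.Rational.Properties as ℚ
open import Data.Rational.Solver using (module +-*-Solver)
import Data.Rational.Unnormalised as ℚᵘ
import Data.Rational.Unnormalised.Properties as ℚᵘ
open import Data.Sum using (_⊎_; inj₁; inj₂)
open import Data.Vec.Functional using (head; tail)
open import Function using (_∘_)
open import Function.Bundles using (mk⇔; Equivalence)
import Function.Properties.Equivalence as ⇔
open import Relation.Binary using (tri<; tri≈; tri>)
open import Relation.Binary.PropositionalEquality
open import Relation.Nullary using (¬_; Dec; yes; no)

open Equivalence using (to; from)
open ≡-Reasoning

module ℚΣ = SemiringSum (CommutativeRing.semiring ℚ.+-*-commutativeRing)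
module ℤΣ = MonoidSum ℤ.+-0-monoid

/1≡fromℤ : ∀ a → a / 1 ≡ fromℤ a
/1≡fromℤ a = ℚ.↥p/↧p≡p (fromℤ a)

/1-homo-+ : ∀ a b → (a ℤ.+ b) / 1 ≡ a / 1 + b / 1
/1-homo-+ a b rewrite /1≡fromℤ (a ℤ.+ b) | /1≡fromℤ a | /1≡fromℤ b =
  ℚ.toℚᵘ-injective (ℚᵘ.≃-sym (ℚᵘ.≃-trans (ℚ.toℚᵘ-homo-+ (fromℤ a) (fromℤ b))
    (ℚᵘ.*≡* (cong (ℤ._* ℤ.+ 1) (cong₂ ℤ._+_ (ℤ.*-identityʳ a) (ℤ.*-identityʳ b))))))

/1-homo-* : ∀ a b → (a ℤ.* b) / 1 ≡ a / 1 * (b / 1)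
/1-homo-* a b rewrite /1≡fromℤ (a ℤ.* b) | /1≡fromℤ a | /1≡fromℤ b =
  ℚ.toℚᵘ-injective (ℚᵘ.≃-sym (ℚᵘ.≃-trans (ℚ.toℚᵘ-homo-* (fromℤ a) (fromℤ b)) (ℚᵘ.*≡* refl)))

Σᶠ≡sum : ∀ {k} (f : Fin k → ℚ) → Σᶠ f ≡ ℚΣ.sum f
Σᶠ≡sum {zero}  f = refl
Σᶠ≡sum {suc k} f = cong (f zero +_) (Σᶠ≡sum (tail f))

Σᶠ-cong : ∀ {k} {f g : Fin k → ℚ} → (∀ j → f j ≡ g j) → Σᶠ f ≡ Σᶠ g
Σᶠ-cong {zero}  f≗g = refl
Σᶠ-cong {suc k} f≗g = cong₂ _+_ (f≗g zero) (Σᶠ-cong (f≗g ∘ suc))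

Σᶠ-distrib-+ : ∀ {k} (f g : Fin k → ℚ) → Σᶠ (λ j → f j + g j) ≡ Σᶠ f + Σᶠ g
Σᶠ-distrib-+ f g = begin
  Σᶠ (λ j → f j + g j)     ≡⟨ Σᶠ≡sum (λ j → f j + g j) ⟩
  ℚΣ.sum (λ j → f j + g j) ≡⟨ ℚΣ.∑-distrib-+ f g ⟩
  ℚΣ.sum f + ℚΣ.sum g      ≡⟨ cong₂ _+_ (Σᶠ≡sum f) (Σᶠ≡sum g) ⟨
  Σᶠ f + Σᶠ g              ∎

*-distribˡ-Σᶠ : ∀ {k} c (f : Fin k → ℚ) → c * Σᶠ f ≡ Σᶠ (λ j → c * f j)
*-distribˡ-Σᶠ c f = begin
  c * Σᶠ f                 ≡⟨ cong (c *_) (Σᶠ≡sum f) ⟩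
  c * ℚΣ.sum f             ≡⟨ ℚΣ.*-distribˡ-sum c f ⟩
  ℚΣ.sum (λ j → c * f j)   ≡⟨ Σᶠ≡sum (λ j → c * f j) ⟨
  Σᶠ (λ j → c * f j)       ∎

*-distribʳ-Σᶠ : ∀ {k} c (f : Fin k → ℚ) → Σᶠ f * c ≡ Σᶠ (λ j → f j * c)
*-distribʳ-Σᶠ c f = begin
  Σᶠ f * c                 ≡⟨ cong (_* c) (Σᶠ≡sum f) ⟩
  ℚΣ.sum f * c             ≡⟨ ℚΣ.*-distribʳ-sum c f ⟩
  ℚΣ.sum (λ j → f j * c)   ≡⟨ Σᶠ≡sum (λ j → f j * c) ⟨
  Σᶠ (λ j → f j * c)       ∎

Σᶠ-comm : ∀ {k l} (f : Fin k → Fin l → ℚ) →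
  Σᶠ (λ i → Σᶠ (f i)) ≡ Σᶠ (λ j → Σᶠ (λ i → f i j))
Σᶠ-comm f = begin
  Σᶠ (λ i → Σᶠ (f i))                  ≡⟨ Σᶠ≡sum (λ i → Σᶠ (f i)) ⟩
  ℚΣ.sum (λ i → Σᶠ (f i))              ≡⟨ ℚΣ.sum-cong-≗ (Σᶠ≡sum ∘ f) ⟩
  ℚΣ.sum (λ i → ℚΣ.sum (f i))          ≡⟨ ℚΣ.∑-comm f ⟩
  ℚΣ.sum (λ j → ℚΣ.sum (λ i → f i j))  ≡⟨ ℚΣ.sum-cong-≗ (λ j → Σᶠ≡sum (λ i → f i j)) ⟨
  ℚΣ.sum (λ j → Σᶠ (λ i → f i j))      ≡⟨ Σᶠ≡sum (λ j → Σᶠ (λ i → f i j)) ⟨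
  Σᶠ (λ j → Σᶠ (λ i → f i j))          ∎

Σᶠ-zero : ∀ k → Σᶠ {k} (λ _ → 0ℚ) ≡ 0ℚ
Σᶠ-zero k = trans (Σᶠ≡sum {k} (λ _ → 0ℚ)) (ℚΣ.sum-replicate-zero k)

δ : ∀ {k} → Fin k → Fin k → ℚ
δ zero    zero    = 1ℚ
δ zero    (suc _) = 0ℚ
δ (suc _) zero    = 0ℚ
δ (suc i) (suc j) = δ i j

δ-nonNeg : ∀ {k} (i j : Fin k) → 0ℚ ≤ δ i j
δ-nonNeg zero    zero    = ℚ.nonNegative⁻¹ 1ℚ
δ-nonNeg zero    (suc _) = ℚ.≤-refl
δ-nonNeg (suc _) zero    = ℚ.≤-refl
δ-nonNeg (suc i) (suc j) = δ-nonNeg i j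

Σᶠ-δ : ∀ {k} (i : Fin k) (f : Fin k → ℚ) → Σᶠ (λ j → δ i j * f j) ≡ f i
Σᶠ-δ {suc k} zero f = begin
  1ℚ * f zero + Σᶠ (λ j → 0ℚ * f (suc j))  ≡⟨ cong₂ _+_ (ℚ.*-identityˡ (f zero)) (Σᶠ-cong (ℚ.*-zeroˡ ∘ tail f)) ⟩
  f zero + Σᶠ {k} (λ _ → 0ℚ)               ≡⟨ cong (f zero +_) (Σᶠ-zero k) ⟩
  f zero + 0ℚ                              ≡⟨ ℚ.+-identityʳ _ ⟩
  f zero                                   ∎
Σᶠ-δ {suc k} (suc i) f =
  trans (cong₂ _+_ (ℚ.*-zeroˡ (f zero)) (Σᶠ-δ i (tail f))) (ℚ.+-identityˡ _)

Σᶠ-δ≡1 : ∀ {k} (i : Fin k) → Σᶠ (δ i) ≡ 1ℚ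
Σᶠ-δ≡1 i = trans (Σᶠ-cong (sym ∘ ℚ.*-identityʳ ∘ δ i)) (Σᶠ-δ i (λ _ → 1ℚ))

lincomb : ∀ {n k} → (Fin k → ℚ) → (Fin k → Point n) → Point n
lincomb w p i = Σᶠ (λ j → w j * p j i)

conv-generator : ∀ {n k} (p : Fin k → Point n) j → conv p (p j)
conv-generator p j = δ j , δ-nonNeg j , Σᶠ-δ≡1 j , λ i → sym (Σᶠ-δ j (λ j′ → p j′ i))

conv-constant : ∀ {n k} {p : Fin k → Point n} {c x : Point n} →
  (∀ j → p j ≈ c) → conv p x → x ≈ c
conv-constant {p = p} {c} {x} p≈c (w , _ , Σw≡1 , x≈) i = begin
  x i                      ≡⟨ x≈ i ⟩
  Σᶠ (λ j → w j * p j i)   ≡⟨ Σᶠ-cong (λ j → cong (w j *_) (p≈c j i)) ⟩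
  Σᶠ (λ j → w j * c i)     ≡⟨ *-distribʳ-Σᶠ (c i) w ⟨
  Σᶠ w * c i               ≡⟨ cong (_* c i) Σw≡1 ⟩
  1ℚ * c i                 ≡⟨ ℚ.*-identityˡ (c i) ⟩
  c i                      ∎

conv-cong : ∀ {n k} {p q : Fin k → Point n} → (∀ j → p j ≈ q j) → conv p ≐ conv q
conv-cong p≈q x = mk⇔ (move p≈q) (move (λ j i → sym (p≈q j i)))
  where
  move : ∀ {p q} → (∀ j → p j ≈ q j) → conv p x → conv q x
  move p≈q (w , w≥0 , Σw≡1 , x≈) =
    w , w≥0 , Σw≡1 , λ i → trans (x≈ i) (Σᶠ-cong (λ j → cong (w j *_) (p≈q j i)))

AtMostOnePoint : ∀ {n} → PSet n → Set
AtMostOnePoint S = ∀ x y → S x → S y → x ≈ y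

≈-dec : ∀ {n} (x y : Point n) → Dec (x ≈ y)
≈-dec x y = all? (λ i → x i ℚ.≟ y i)

polytope-atMostOnePoint⊎moreThanOnePoint : ∀ {n k} {S : PSet n} (p : Fin (suc k) → Point n) →
  S ≐ conv p → AtMostOnePoint S ⊎ MoreThanOnePoint S
polytope-atMostOnePoint⊎moreThanOnePoint {S = S} p S≐conv with all? (λ j → ≈-dec (p j) (p zero))
... | yes p≈p₀ = inj₁ λ x y Sx Sy i → trans (on-p₀ Sx i) (sym (on-p₀ Sy i))
  where
  on-p₀ : ∀ {x} → S x → x ≈ p zero
  on-p₀ {x} Sx = conv-constant p≈p₀ (to (S≐conv x) Sx)
... | no ¬p≈p₀ with ¬∀⟶∃¬ _ _ (λ j → ≈-dec (p j) (p zero)) ¬p≈p₀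
...   | j , pⱼ≉p₀ =
  inj₂ (p j , p zero , in-S j , in-S zero , pⱼ≉p₀)
  where
  in-S : ∀ j → S (p j)
  in-S j = from (S≐conv (p j)) (conv-generator p j)

integralPolytope-atMostOnePoint⊎moreThanOnePoint : ∀ {n} {S : PSet n} →
  IsIntegralPolytope S → AtMostOnePoint S ⊎ MoreThanOnePoint S
integralPolytope-atMostOnePoint⊎moreThanOnePoint (_ , g , S≐conv) =
  polytope-atMostOnePoint⊎moreThanOnePoint (embed ∘ g) S≐conv

apply-cong : ∀ {m n} (M : IntMatrix m n) {x y : Point n} → x ≈ y → apply M x ≈ apply M y
apply-cong M x≈y i = Σᶠ-cong (λ j → cong ((M i j / 1) *_) (x≈y j))

apply-⊕ : ∀ {m n} (M : IntMatrix m n) (x y : Point n) →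
  apply M (x ⊕ y) ≈ apply M x ⊕ apply M y
apply-⊕ M x y i = trans (Σᶠ-cong (λ j → ℚ.*-distribˡ-+ (M i j / 1) (x j) (y j)))
                        (Σᶠ-distrib-+ (λ j → (M i j / 1) * x j) (λ j → (M i j / 1) * y j))

apply-lincomb : ∀ {m n k} (M : IntMatrix m n) (w : Fin k → ℚ) (p : Fin k → Point n) →
  apply M (lincomb w p) ≈ lincomb w (apply M ∘ p)
apply-lincomb {n = n} M w p i = begin
  Σᶠ (λ l → Mᵢ l * Σᶠ (λ j → w j * p j l))   ≡⟨ Σᶠ-cong (λ l → *-distribˡ-Σᶠ (Mᵢ l) (λ j → w j * p j l)) ⟩
  Σᶠ (λ l → Σᶠ (λ j → Mᵢ l * (w j * p j l))) ≡⟨ Σᶠ-comm (λ l j → Mᵢ l * (w j * p j l)) ⟩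
  Σᶠ (λ j → Σᶠ (λ l → Mᵢ l * (w j * p j l))) ≡⟨ Σᶠ-cong (λ j → Σᶠ-cong (λ l → swap (Mᵢ l) (w j) (p j l))) ⟩
  Σᶠ (λ j → Σᶠ (λ l → w j * (Mᵢ l * p j l))) ≡⟨ Σᶠ-cong (λ j → *-distribˡ-Σᶠ (w j) (λ l → Mᵢ l * p j l)) ⟨
  Σᶠ (λ j → w j * Σᶠ (λ l → Mᵢ l * p j l))   ∎
  where
  Mᵢ : Fin n → ℚ
  Mᵢ l = M i l / 1
  open +-*-Solver
  swap : ∀ a b c → a * (b * c) ≡ b * (a * c)
  swap = solve 3 (λ a b c → a :* (b :* c) := b :* (a :* c)) refl

image-conv : ∀ {m n k} (M : IntMatrix m n) {S : PSet n} (p : Fin k → Point n) →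
  S ≐ conv p → image M S ≐ conv (apply M ∘ p)
image-conv M {S} p S≐conv y = mk⇔ forward backward
  where
  forward : image M S y → conv (apply M ∘ p) y
  forward (x , Sx , Mx≈y) with to (S≐conv x) Sx
  ... | w , w≥0 , Σw≡1 , x≈ =
    w , w≥0 , Σw≡1 , λ i → trans (sym (Mx≈y i)) (trans (apply-cong M x≈ i) (apply-lincomb M w p i))
  backward : conv (apply M ∘ p) y → image M S y
  backward (w , w≥0 , Σw≡1 , y≈) =
    lincomb w p , from (S≐conv _) (w , w≥0 , Σw≡1 , λ _ → refl) ,
    λ i → trans (apply-lincomb M w p i) (sym (y≈ i))

applyℤ : ∀ {m n} → IntMatrix m n → ZPoint n → ZPoint m
applyℤ M z i = ℤΣ.sum (λ j → M i j ℤ.* z j)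

sum-/1 : ∀ {k} (f : Fin k → ℤ) → ℤΣ.sum f / 1 ≡ Σᶠ (λ j → f j / 1)
sum-/1 {zero}  f = refl
sum-/1 {suc k} f = trans (/1-homo-+ (f zero) _) (cong (f zero / 1 +_) (sum-/1 (tail f)))

apply-embed : ∀ {m n} (M : IntMatrix m n) (z : ZPoint n) → apply M (embed z) ≈ embed (applyℤ M z)
apply-embed M z i = sym (trans (sum-/1 (λ j → M i j ℤ.* z j)) (Σᶠ-cong (λ j → /1-homo-* (M i j) (z j))))

image-isIntegralPolytope : ∀ {m n} (M : IntMatrix m n) {S : PSet n} →
  IsIntegralPolytope S → IsIntegralPolytope (image M S)
image-isIntegralPolytope M (k , g , S≐conv) =
  k , applyℤ M ∘ g , λ y → ⇔.trans (image-conv M (embed ∘ g) S≐conv y)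
                                    (conv-cong (λ j → apply-embed M (g j)) y)

infix 4 _≤ₗₑₓ_

data _≤ₗₑₓ_ : ∀ {m} → Point m → Point m → Set where
  base : {x y : Point zero} → x ≤ₗₑₓ y
  this : ∀ {m} {x y : Point (suc m)} → head x < head y → x ≤ₗₑₓ y
  next : ∀ {m} {x y : Point (suc m)} → head x ≡ head y → tail x ≤ₗₑₓ tail y → x ≤ₗₑₓ y

≤ₗₑₓ-head : ∀ {m} {x y : Point (suc m)} → x ≤ₗₑₓ y → head x ≤ head y
≤ₗₑₓ-head (this x₀<y₀)   = ℚ.<⇒≤ x₀<y₀
≤ₗₑₓ-head (next x₀≡y₀ _) = ℚ.≤-reflexive x₀≡y₀

≤ₗₑₓ-reflexive : ∀ {m} {x y : Point m} → x ≈ y → x ≤ₗₑₓ y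
≤ₗₑₓ-reflexive {zero}  _   = base
≤ₗₑₓ-reflexive {suc m} x≈y = next (x≈y zero) (≤ₗₑₓ-reflexive (x≈y ∘ suc))

≤ₗₑₓ-trans : ∀ {m} {x y z : Point m} → x ≤ₗₑₓ y → y ≤ₗₑₓ z → x ≤ₗₑₓ z
≤ₗₑₓ-trans base               base               = base
≤ₗₑₓ-trans (this x₀<y₀)       y≤z                = this (ℚ.<-≤-trans x₀<y₀ (≤ₗₑₓ-head y≤z))
≤ₗₑₓ-trans (next x₀≡y₀ _)     (this y₀<z₀)       = this (ℚ.≤-<-trans (ℚ.≤-reflexive x₀≡y₀) y₀<z₀)
≤ₗₑₓ-trans (next x₀≡y₀ xs≤ys) (next y₀≡z₀ ys≤zs) = next (trans x₀≡y₀ y₀≡z₀) (≤ₗₑₓ-trans xs≤ys ys≤zs)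

≤ₗₑₓ-total : ∀ {m} (x y : Point m) → x ≤ₗₑₓ y ⊎ y ≤ₗₑₓ x
≤ₗₑₓ-total {zero}  x y = inj₁ base
≤ₗₑₓ-total {suc m} x y with ℚ.<-cmp (head x) (head y) | ≤ₗₑₓ-total (tail x) (tail y)
... | tri< x₀<y₀ _ _ | _          = inj₁ (this x₀<y₀)
... | tri> _ _ y₀<x₀ | _          = inj₂ (this y₀<x₀)
... | tri≈ _ x₀≡y₀ _ | inj₁ xs≤ys = inj₁ (next x₀≡y₀ xs≤ys)
... | tri≈ _ x₀≡y₀ _ | inj₂ ys≤xs = inj₂ (next (sym x₀≡y₀) ys≤xs)

⊕-mono-≤ₗₑₓ : ∀ {m} {x y x′ y′ : Point m} → x ≤ₗₑₓ y → x′ ≤ₗₑₓ y′ → x ⊕ x′ ≤ₗₑₓ y ⊕ y′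
⊕-mono-≤ₗₑₓ base               base                 = base
⊕-mono-≤ₗₑₓ (this x₀<y₀)       x′≤y′                = this (ℚ.+-mono-<-≤ x₀<y₀ (≤ₗₑₓ-head x′≤y′))
⊕-mono-≤ₗₑₓ (next x₀≡y₀ _)     (this x′₀<y′₀)       = this (ℚ.+-mono-≤-< (ℚ.≤-reflexive x₀≡y₀) x′₀<y′₀)
⊕-mono-≤ₗₑₓ (next x₀≡y₀ xs≤ys) (next x′₀≡y′₀ x′s≤y′s) =
  next (cong₂ _+_ x₀≡y₀ x′₀≡y′₀) (⊕-mono-≤ₗₑₓ xs≤ys x′s≤y′s)

·-monoˡ-≤ₗₑₓ-pos : ∀ {m} t → 0ℚ < t → {x y : Point m} → x ≤ₗₑₓ y → t · x ≤ₗₑₓ t · y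
·-monoˡ-≤ₗₑₓ-pos t _   base               = base
·-monoˡ-≤ₗₑₓ-pos t 0<t (this x₀<y₀)       = this (ℚ.*-monoʳ-<-pos t {{positive 0<t}} x₀<y₀)
·-monoˡ-≤ₗₑₓ-pos t 0<t (next x₀≡y₀ xs≤ys) = next (cong (t *_) x₀≡y₀) (·-monoˡ-≤ₗₑₓ-pos t 0<t xs≤ys)

·-monoˡ-≤ₗₑₓ-nonNeg : ∀ {m} t → 0ℚ ≤ t → {x y : Point m} → x ≤ₗₑₓ y → t · x ≤ₗₑₓ t · y
·-monoˡ-≤ₗₑₓ-nonNeg t 0≤t {x} {y} x≤y with ℚ.<-cmp 0ℚ t
... | tri< 0<t _ _    = ·-monoˡ-≤ₗₑₓ-pos t 0<t x≤y
... | tri≈ _ refl _   = ≤ₗₑₓ-reflexive (λ i → trans (ℚ.*-zeroˡ (x i)) (sym (ℚ.*-zeroˡ (y i))))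
... | tri> _ _ t<0    = ⊥-elim (ℚ.<-irrefl refl (ℚ.<-≤-trans t<0 0≤t))

lincomb-≤ₗₑₓ : ∀ {m k} (w : Fin k → ℚ) (p : Fin k → Point m) {v : Point m} →
  (∀ j → 0ℚ ≤ w j) → (∀ j → p j ≤ₗₑₓ v) → lincomb w p ≤ₗₑₓ Σᶠ w · v
lincomb-≤ₗₑₓ {k = zero}  w p {v} _ _ = ≤ₗₑₓ-reflexive (λ i → sym (ℚ.*-zeroˡ (v i)))
lincomb-≤ₗₑₓ {k = suc k} w p {v} w≥0 p≤v =
  ≤ₗₑₓ-trans (⊕-mono-≤ₗₑₓ (·-monoˡ-≤ₗₑₓ-nonNeg (w zero) (w≥0 zero) (p≤v zero))
                          (lincomb-≤ₗₑₓ (tail w) (tail p) (w≥0 ∘ suc) (p≤v ∘ suc)))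
             (≤ₗₑₓ-reflexive (λ i → sym (ℚ.*-distribʳ-+ (v i) (w zero) (Σᶠ (tail w)))))

conv-≤ₗₑₓ : ∀ {m k} {p : Fin k → Point m} {v x : Point m} → (∀ j → p j ≤ₗₑₓ v) → conv p x → x ≤ₗₑₓ v
conv-≤ₗₑₓ {p = p} {v} p≤v (w , w≥0 , Σw≡1 , x≈) =
  ≤ₗₑₓ-trans (≤ₗₑₓ-reflexive x≈)
    (≤ₗₑₓ-trans (lincomb-≤ₗₑₓ w p w≥0 p≤v)
      (≤ₗₑₓ-reflexive (λ i → trans (cong (_* v i) Σw≡1) (ℚ.*-identityˡ (v i)))))

lex-max : ∀ {m k} (q : Fin (suc k) → Point m) → ∃ λ j → ∀ j′ → q j′ ≤ₗₑₓ q j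
lex-max {k = zero}  q = zero , λ { zero → ≤ₗₑₓ-reflexive (λ _ → refl) }
lex-max {k = suc k} q with lex-max (tail q)
... | j , tail-q≤ with ≤ₗₑₓ-total (q zero) (q (suc j))
...   | inj₁ q₀≤ = suc j , λ { zero → q₀≤ ; (suc j′) → tail-q≤ j′ }
...   | inj₂ ≤q₀ = zero , λ { zero → ≤ₗₑₓ-reflexive (λ _ → refl) ; (suc j′) → ≤ₗₑₓ-trans (tail-q≤ j′) ≤q₀ }

t<1⇒0<1-t : ∀ {t} → t < 1ℚ → 0ℚ < 1ℚ - t
t<1⇒0<1-t {t} t<1 = subst (_< 1ℚ - t) (ℚ.+-inverseʳ t) (ℚ.+-monoˡ-< (- t) t<1)

convex-idem : ∀ t v → t * v + (1ℚ - t) * v ≡ v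
convex-idem = solve 2 (λ t v → t :* v :+ (con 1ℚ :- t) :* v := v) refl
  where open +-*-Solver

convex-<ˡ : ∀ {t a b v} → 0ℚ < t → t < 1ℚ → a < v → b ≤ v → t * a + (1ℚ - t) * b < v
convex-<ˡ {t} {a} {b} {v} 0<t t<1 a<v b≤v = subst (t * a + (1ℚ - t) * b <_) (convex-idem t v)
  (ℚ.+-mono-<-≤ (ℚ.*-monoʳ-<-pos t {{positive 0<t}} a<v)
                (ℚ.*-monoˡ-≤-nonNeg (1ℚ - t) {{nonNegative (ℚ.<⇒≤ (t<1⇒0<1-t t<1))}} b≤v))

convex-<ʳ : ∀ {t a b v} → 0ℚ < t → t < 1ℚ → a ≤ v → b < v → t * a + (1ℚ - t) * b < v
convex-<ʳ {t} {a} {b} {v} 0<t t<1 a≤v b<v = subst (t * a + (1ℚ - t) * b <_) (convex-idem t v)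
  (ℚ.+-mono-≤-< (ℚ.*-monoˡ-≤-nonNeg t {{nonNegative (ℚ.<⇒≤ 0<t)}} a≤v)
                (ℚ.*-monoʳ-<-pos (1ℚ - t) {{positive (t<1⇒0<1-t t<1)}} b<v))

≈-cons : ∀ {m} {x y : Point (suc m)} → head x ≡ head y → tail x ≈ tail y → x ≈ y
≈-cons x₀≡y₀ _     zero    = x₀≡y₀
≈-cons _     xs≈ys (suc i) = xs≈ys i

lex-extreme : ∀ {m} {x y v : Point m} {t} → 0ℚ < t → t < 1ℚ → x ≤ₗₑₓ v → y ≤ₗₑₓ v →
  v ≈ t · x ⊕ (1ℚ - t) · y → x ≈ v × y ≈ v
lex-extreme _ _ base base _ = (λ ()) , (λ ())
lex-extreme 0<t t<1 (this x₀<v₀) y≤v v≈ =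
  ⊥-elim (ℚ.<-irrefl (sym (v≈ zero)) (convex-<ˡ 0<t t<1 x₀<v₀ (≤ₗₑₓ-head y≤v)))
lex-extreme 0<t t<1 (next x₀≡v₀ _) (this y₀<v₀) v≈ =
  ⊥-elim (ℚ.<-irrefl (sym (v≈ zero)) (convex-<ʳ 0<t t<1 (ℚ.≤-reflexive x₀≡v₀) y₀<v₀))
lex-extreme 0<t t<1 (next x₀≡v₀ xs≤vs) (next y₀≡v₀ ys≤vs) v≈
  with lex-extreme 0<t t<1 xs≤vs ys≤vs (v≈ ∘ suc)
... | xs≈vs , ys≈vs = ≈-cons x₀≡v₀ xs≈vs , ≈-cons y₀≡v₀ ys≈vs

polytope-vertex : ∀ {n k} {S : PSet n} (p : Fin (suc k) → Point n) → S ≐ conv p → ∃ (IsVertex S)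
polytope-vertex {S = S} p S≐conv with lex-max p
... | j , p≤pⱼ = p j , from (S≐conv (p j)) (conv-generator p j) , extreme
  where
  extreme : ∀ x y t → S x → S y → 0ℚ < t → t < 1ℚ → p j ≈ t · x ⊕ (1ℚ - t) · y → x ≈ p j × y ≈ p j
  extreme x y _ Sx Sy 0<t t<1 =
    lex-extreme 0<t t<1 (conv-≤ₗₑₓ p≤pⱼ (to (S≐conv x) Sx)) (conv-≤ₗₑₓ p≤pⱼ (to (S≐conv y) Sy))

integralPolytope-vertex : ∀ {n} {S : PSet n} → IsIntegralPolytope S → ∃ (IsVertex S)
integralPolytope-vertex (_ , g , S≐conv) = polytope-vertex (embed ∘ g) S≐conv

≐-trans : ∀ {n} {S T U : PSet n} → S ≐ T → T ≐ U → S ≐ U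
≐-trans S≐T T≐U x = ⇔.trans (S≐T x) (T≐U x)

⊞-comm : ∀ {n} (A B : PSet n) → (A ⊞ B) ≐ (B ⊞ A)
⊞-comm A B x = mk⇔ (swap A B) (swap B A)
  where
  swap : ∀ A B → (A ⊞ B) x → (B ⊞ A) x
  swap _ _ (a , b , Aa , Bb , x≈a⊕b) = b , a , Bb , Aa , λ i → trans (x≈a⊕b i) (ℚ.+-comm (a i) (b i))

image-cong : ∀ {m n} (M : IntMatrix m n) {S T : PSet n} → S ≐ T → image M S ≐ image M T
image-cong M S≐T y = mk⇔ (λ (x , Sx , Mx≈y) → x , to (S≐T x) Sx , Mx≈y)
                         (λ (x , Tx , Mx≈y) → x , from (S≐T x) Tx , Mx≈y)

image-⊞ : ∀ {m n} (M : IntMatrix m n) (A B : PSet n) → image M (A ⊞ B) ≐ (image M A ⊞ image M B)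
image-⊞ M A B y = mk⇔ forward backward
  where
  forward : image M (A ⊞ B) y → (image M A ⊞ image M B) y
  forward (x , (a , b , Aa , Bb , x≈a⊕b) , Mx≈y) =
    apply M a , apply M b , (a , Aa , λ _ → refl) , (b , Bb , λ _ → refl) ,
    λ i → trans (sym (Mx≈y i)) (trans (apply-cong M x≈a⊕b i) (apply-⊕ M a b i))
  backward : (image M A ⊞ image M B) y → image M (A ⊞ B) y
  backward (_ , _ , (a , Aa , Ma≈) , (b , Bb , Mb≈) , y≈) =
    a ⊕ b , (a , b , Aa , Bb , λ _ → refl) ,
    λ i → trans (apply-⊕ M a b i) (trans (cong₂ _+_ (Ma≈ i) (Mb≈ i)) (sym (y≈ i)))

Fibre : ∀ {m n} → IntMatrix m n → PSet n → Point m → PSet n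
Fibre M P y x = P x × apply M x ≈ y

atMostOnePoint⇒¬moreThanOnePoint : ∀ {n} {S : PSet n} → AtMostOnePoint S → ¬ MoreThanOnePoint S
atMostOnePoint⇒¬moreThanOnePoint S≤1 (x , y , Sx , Sy , x≉y) = x≉y (S≤1 x y Sx Sy)

⊕-cancelʳ : ∀ {n} {x y z : Point n} → x ⊕ z ≈ y ⊕ z → x ≈ y
⊕-cancelʳ {z = z} x⊕z≈y⊕z i = GroupProperties.∙-cancelʳ ℚ.+-0-group (z i) _ _ (x⊕z≈y⊕z i)

fibre-moreThanOnePoint : ∀ {m n} (M : IntMatrix m n) {P A B : PSet n} {y : Point m} →
  P ≐ (A ⊞ B) → MoreThanOnePoint A → AtMostOnePoint (image M A) → image M P y →
  MoreThanOnePoint (Fibre M P y)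
fibre-moreThanOnePoint M {P} {A} {y = y} P≐A⊞B (a₁ , a₂ , Aa₁ , Aa₂ , a₁≉a₂) MA≤1 (x , Px , Mx≈y)
  with to (P≐A⊞B x) Px
... | a , b , Aa , Bb , x≈a⊕b =
  a₁ ⊕ b , a₂ ⊕ b , in-fibre Aa₁ , in-fibre Aa₂ , λ a₁⊕b≈a₂⊕b → a₁≉a₂ (⊕-cancelʳ a₁⊕b≈a₂⊕b)
  where
  in-fibre : ∀ {a′} → A a′ → Fibre M P y (a′ ⊕ b)
  in-fibre {a′} Aa′ = from (P≐A⊞B _) (a′ , b , Aa′ , Bb , λ _ → refl) , λ i → begin
    apply M (a′ ⊕ b) i           ≡⟨ apply-⊕ M a′ b i ⟩
    apply M a′ i + apply M b i   ≡⟨ cong (_+ apply M b i) (MA≤1 _ _ (a′ , Aa′ , λ _ → refl) (a , Aa , λ _ → refl) i) ⟩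
    apply M a i + apply M b i    ≡⟨ apply-⊕ M a b i ⟨
    apply M (a ⊕ b) i            ≡⟨ apply-cong M x≈a⊕b i ⟨
    apply M x i                  ≡⟨ Mx≈y i ⟩
    y i                          ∎

summand-image-moreThanOnePoint : ∀ {m n} (M : IntMatrix m n) {P A B : PSet n} {y : Point m} →
  P ≐ (A ⊞ B) → IsIntegralPolytope A → MoreThanOnePoint A → image M P y →
  AtMostOnePoint (Fibre M P y) → MoreThanOnePoint (image M A)
summand-image-moreThanOnePoint M P≐A⊞B A-poly A₂ y∈MP fibre≤1
  with integralPolytope-atMostOnePoint⊎moreThanOnePoint (image-isIntegralPolytope M A-poly)
... | inj₂ MA₂ = MA₂
... | inj₁ MA≤1 =
  ⊥-elim (atMostOnePoint⇒¬moreThanOnePoint fibre≤1 (fibre-moreThanOnePoint M P≐A⊞B A₂ MA≤1 y∈MP))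

lemma7 : (n m : ℕ) (P : PSet n) (M : IntMatrix m n) →
    IsIntegralPolytope P →
    IntegrallyIndecomposable (image M P) →
    (∀ v → IsVertex (image M P) v →
       ∀ x x' → P x → P x' → apply M x ≈ v → apply M x' ≈ v → x ≈ x') →
    IntegrallyIndecomposable P
lemma7 n m P M P-poly MP-indecomposable injective-over-vertices (A , B , A-poly , B-poly , A₂ , B₂ , P≐A⊞B) =
  MP-indecomposable (image M A , image M B ,
    image-isIntegralPolytope M A-poly , image-isIntegralPolytope M B-poly ,
    summand-image-moreThanOnePoint M P≐A⊞B A-poly A₂ v∈MP fibre-over-v-trivial ,
    summand-image-moreThanOnePoint M (≐-trans P≐A⊞B (⊞-comm A B)) B-poly B₂ v∈MP fibre-over-v-trivial ,
    ≐-trans (image-cong M P≐A⊞B) (image-⊞ M A B))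
  where
  vertex : ∃ (IsVertex (image M P))
  vertex = integralPolytope-vertex (image-isIntegralPolytope M P-poly)
  v : Point m
  v = proj₁ vertex
  v∈MP : image M P v
  v∈MP = proj₁ (proj₂ vertex)
  fibre-over-v-trivial : AtMostOnePoint (Fibre M P v)
  fibre-over-v-trivial x x′ (Px , Mx≈v) (Px′ , Mx′≈v) =
    injective-over-vertices v (proj₂ vertex) x x′ Px Px′ Mx≈v Mx′≈v
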